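{- In the setting of the procedure AbstractFlow described in the context, for all indices $i$, $j$, and all $\ell\le k$ with $k>j$, there is no $s_i$-to-$t_j$ path in $G$ that is residual with respect to $\mathbf{c}_{\ell k}$.
   Context: $G$ is a planar embedded graph; each edge is viewed as two oppositely directed darts, and every dart $d$ has a capacity $\mathbf{c}[d]\ge 0$ (capacities need not be symmetric). A flow $\mathbf{f}$ is an antisymmetric assignment of reals to darts ($\mathbf{f}[\mathrm{rev}(d)]=-\mathbf{f}[d]$) with $\mathbf{f}[d]\le \mathbf{c}[d]$, balanced at every non-terminal vertex; its value is the net flow entering the sinks. The residual capacities w.r.t. $\mathbf{f}$ are $\mathbf{c}_{\mathbf{f}}[d]=\mathbf{c}[d]-\mathbf{f}[d]$. A path or cycle is residual w.r.t. given capacities if every dart on it has strictly positive capacity. The face $f_\infty$ chosen as the infinite face contains all terminals on its boundary; clockwise/counterclockwise for simple cycles is with respect to this choice. A flow is leftmost (w.r.t. capacities $\mathbf{c}$) if no clockwise cycle is residual w.r.t. $\mathbf{c}_{\mathbf{f}}$. The terminals are sources and sinks alternating along the boundary in clockwise order $s_1,t_1,s_2,t_2,\dots,s_m,t_m$. Procedure AbstractFlow: first, starting from $\mathbf{c}$, saturate all $s_j$-to-$t_i$ residual paths for all $i<j$ and all clockwise residual cycles, obtaining residual capacities $\mathbf{c}_0$ with respect to which no clockwise cycle and no $s_j$-to-$t_i$ path ($i<j$) is residual. Then for $j=1,2,\dots,m$ and, inside, for $i=j,j-1,\dots,1$: let $\mathbf{c}'_{ij}$ be the current residual capacities; let $\mathbf{f}_{ij}$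 be a leftmost maximum $s_i$-to-$t_j$ flow w.r.t. $\mathbf{c}'_{ij}$; let $\mathbf{c}_{ij}$ be the residual capacities of $\mathbf{c}'_{ij}$ w.r.t. $\mathbf{f}_{ij}$ (these become the current residual capacities).
   Formalization: The capacities, the flows and all residual capacities take rational values on the darts instead of real ones. -}

module Defs where

open import Data.Nat using (ℕ; zero; suc; _+_; _*_; _<_; _≤_)
open import Data.Fin using (Fin; zero; suc; toℕ; _≟_)
open import Data.Rational as ℚ using (ℚ; 0ℚ; _-_)
open import Data.List using (List; []; _∷_; map)
open import Data.List.Membership.Propositional using (_∈_; _∉_)
open import Data.List.Relation.Unary.All using (All)
open import Data.List.Relation.Unary.Unique.Propositional using (Unique)
open import Data.Product using (Σ; ∃; _×_; _,_)
open import Data.Sum using (_⊎_)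
open import Relation.Binary.PropositionalEquality using (_≡_; _≢_)
open import Relation.Nullary using (¬_; yes; no)

iter : {A : Set} → (A → A) → ℕ → A → A
iter f zero    x = x
iter f (suc k) x = f (iter f k x)

-- Darts are Fin D.  rev is the reversal involution (no fixed points).
-- σ is the CLOCKWISE successor of a dart around its tail vertex.
-- face d is the face lying to the LEFT of d; the face permutation
-- is φ = σ ∘ rev (left face of d equals left face of σ (rev d)).

record CombMap : Set where
  field
    V D F : ℕ
    rev        : Fin D → Fin D
    rev-invol  : ∀ d → rev (rev d) ≡ d
    rev-nofix  : ∀ d → rev d ≢ d
    σ σ⁻¹      : Fin D → Fin D
    σ-inv₁     : ∀ d → σ (σ⁻¹ d) ≡ d
    σ-inv₂     : ∀ d → σ⁻¹ (σ d) ≡ d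
    tail       : Fin D → Fin V
    tail-σ     : ∀ d → tail (σ d) ≡ tail d
    tail-orbit : ∀ d d′ → tail d ≡ tail d′ → ∃ λ k → iter σ k d ≡ d′
    tail-surj  : ∀ v → ∃ λ d → tail d ≡ v
    face       : Fin D → Fin F
    face-φ     : ∀ d → face (σ (rev d)) ≡ face d
    face-orbit : ∀ d d′ → face d ≡ face d′ → ∃ λ k → iter (λ e → σ (rev e)) k d ≡ d′
    face-surj  : ∀ f → ∃ λ d → face d ≡ f

  head : Fin D → Fin V
  head d = tail (rev d)

  φ : Fin D → Fin D
  φ d = σ (rev d)

module _ (M : CombMap) where
  open CombMap M

  data Walk : Fin V → Fin V → List (Fin D) → Set where
    []   : ∀ {u} → Walk u u []
    step : ∀ {u w d ds} → tail d ≡ u → Walk (head d) w ds → Walk u w (d ∷ ds)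

  Connected : Set
  Connected = ∀ u w → ∃ λ ds → Walk u w ds

  IsPath : Fin V → Fin V → List (Fin D) → Set
  IsPath u w ds = Walk u w ds × Unique (u ∷ map head ds)

  IsCycle : List (Fin D) → Set
  IsCycle ds = ∃ λ u → Walk u u ds × ds ≢ [] × Unique (map tail ds)
               × All (λ d → rev d ∉ ds) ds

  data DualReach (C : List (Fin D)) (a : Fin F) : Fin F → Set where
    here  : DualReach C a a
    cross : ∀ d → DualReach C a (face d) → d ∉ C → rev d ∉ C
          → DualReach C a (face (rev d))

-- planar = connected map satisfying Euler's formula V - E + F = 2,
-- with D = 2E darts
IsPlane : CombMap → Set
IsPlane M = Connected M × 2 * (V + F) ≡ D + 4
  where open CombMap M

module Flows (M : CombMap) where
  open CombMap M

  Cap : Set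
  Cap = Fin D → ℚ

  sumFin : ∀ n → (Fin n → ℚ) → ℚ
  sumFin zero    g = 0ℚ
  sumFin (suc n) g = g zero ℚ.+ sumFin n (λ i → g (suc i))

  inflow : Cap → Fin V → ℚ
  inflow f v = sumFin D (λ d → helper (head d ≟ v) (f d))
    where
    helper : ∀ {P : Set} → Relation.Nullary.Dec P → ℚ → ℚ
    helper (yes _) q = q
    helper (no  _) _ = 0ℚ

  residualCap : Cap → Cap → Cap
  residualCap c f d = c d - f d

  NonNeg : Cap → Set
  NonNeg c = ∀ d → 0ℚ ℚ.≤ c d

  IsFlow : Cap → (Fin V → Set) → Cap → Set
  IsFlow c T f = (∀ d → f (rev d) ≡ ℚ.- f d)
               × (∀ d → f d ℚ.≤ c d)
               × (∀ v → ¬ T v → inflow f v ≡ 0ℚ)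

  IsFlowST : Cap → Fin V → Fin V → Cap → Set
  IsFlowST c s t f = IsFlow c (λ v → v ≡ s ⊎ v ≡ t) f

  IsMaxFlowST : Cap → Fin V → Fin V → Cap → Set
  IsMaxFlowST c s t f = IsFlowST c s t f
    × (∀ g → IsFlowST c s t g → inflow g t ℚ.≤ inflow f t)

  Residual : Cap → List (Fin D) → Set
  Residual c ds = All (λ d → 0ℚ ℚ.< c d) ds

  ResidualPath : Cap → Fin V → Fin V → Set
  ResidualPath c u w = ∃ λ ds → IsPath M u w ds × Residual c ds

  -- clockwise simple cycle w.r.t. infinite face finf: finf lies on the
  -- left side of the cycle (the cycle encloses its interior on its right)
  Clockwise : Fin F → List (Fin D) → Set
  Clockwise finf ds = IsCycle M ds
    × ∃ λ d → d ∈ ds × DualReach M ds (face d) finf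

  NoResidualCWCycle : Fin F → Cap → Set
  NoResidualCWCycle finf c = ∀ ds → Clockwise finf ds → ¬ Residual c ds

  IsLeftmost : Fin F → Cap → Cap → Set
  IsLeftmost finf c f = NoResidualCWCycle finf (residualCap c f)

-- Terminal setup: m sources s and m sinks t, pairwise distinct, on the
-- boundary of finf in clockwise order s₀,t₀,s₁,t₁,…  The boundary walk of
-- finf with finf on the left is the φ-orbit of a dart d₀ (clockwise);
-- the terminals occur at strictly increasing positions within one period.

module Terminals (M : CombMap) where
  open CombMap M

  ClockwiseTerminals : Fin F → (m : ℕ) → (Fin m → Fin V) → (Fin m → Fin V) → Set
  ClockwiseTerminals finf m s t =
    (∀ i j → s i ≡ s j → i ≡ j) × (∀ i j → t i ≡ t j → i ≡ j)
    × (∀ i j → s i ≢ t j)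
    × Σ (Fin D) λ d₀ → face d₀ ≡ finf × Σ ℕ λ L →
        iter φ L d₀ ≡ d₀ × (∀ k → 0 < k → k < L → iter φ k d₀ ≢ d₀)
        × Σ (Fin m → ℕ) λ ps → Σ (Fin m → ℕ) λ pt →
            (∀ i → ps i < pt i) × (∀ i → pt i < L)
          × (∀ i j → toℕ j ≡ suc (toℕ i) → pt i < ps j)
          × (∀ i → tail (iter φ (ps i) d₀) ≡ s i)
          × (∀ i → tail (iter φ (pt i) d₀) ≡ t i)

-- The procedure AbstractFlow (0-based indices).  cs i j is c_{ij}; the
-- capacities current before step (i,j) are:

prevCap : {A : Set} → A → (ℕ → ℕ → A) → ℕ → ℕ → A
prevCap c₀ cs i j with Data.Nat._<?_ i j
... | yes _ = cs (suc i) j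
... | no  _ with j
...   | zero  = c₀
...   | suc j′ = cs 0 j′

{-# OPTIONS --safe #-}

-- Let f be a maximum s-t flow for capacities c
-- and suppose that a residual a-b walk w.r.t. c - f appears although none existed w.r.t. c.
-- If t is not reachable from a, let A be the set of vertices reachable from a; if s does not
-- reach b, let A be the set of vertices not reaching b. No c-residual dart leaves A, so f ≤ 0
-- on every dart leaving A and f < 0 on the dart by which the new walk leaves A; this forces a
-- positive net inflow into A, whereas A contains no sink (resp. no source) and so has net
-- inflow ≤ 0. Hence every new residual a-b walk requires a ⇝ t and s ⇝ b beforehand, and s-t
-- itself is blocked by maximality, since a residual s-t path would augment f. Induction over
-- the steps (ℓ, k) then keeps every pair (s i, t j) with j < k, j < i, or j = k and ℓ ≤ i blocked.

module Submission where

open import Defs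

module RationalSums where

  open import Data.Nat using (ℕ; zero; suc)
  open import Data.Fin using (Fin; zero; suc; _≟_)
  open import Data.Fin.Properties using (suc-injective)
  open import Data.Rational using (ℚ; 0ℚ; _+_; _-_; -_; _≤_; _<_)
  open import Data.Rational.Properties as ℚ
    using (+-identityˡ; +-identityʳ; +-inverseʳ; neg-distrib-+; +-mono-≤; +-mono-<-≤; +-mono-≤-<)
  open import Data.Rational.Solver using (module +-*-Solver)
  open import Relation.Binary.PropositionalEquality hiding ([_])
  open import Relation.Nullary using (¬_; Dec; yes; no; ¬?; contradiction)
  open import Relation.Binary.Definitions using (tri<; tri≈; tri>)
  open +-*-Solver

  open import Algebra.Properties.CommutativeMonoid.Sum ℚ.+-0-commutativeMonoid public
    using (sum; sum-syntax; sum-cong-≗; ∑-distrib-+; ∑-comm; ∑-permute; sum-replicate-zero)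

  infixr 11 [_]·_

  [_]·_ : {P : Set} → Dec P → ℚ → ℚ
  [ yes _ ]· q = q
  [ no  _ ]· _ = 0ℚ

  private
    variable
      P Q : Set

  []·-yes : P → (x : Dec P) (q : ℚ) → [ x ]· q ≡ q
  []·-yes p (yes _) q = refl
  []·-yes p (no ¬p) q = contradiction p ¬p

  []·-no : ¬ P → (x : Dec P) (q : ℚ) → [ x ]· q ≡ 0ℚ
  []·-no ¬p (yes p) q = contradiction p ¬p
  []·-no ¬p (no _)  q = refl

  []·-cong-⇔ : (P → Q) → (Q → P) → (x : Dec P) (y : Dec Q) (q : ℚ) →
               [ x ]· q ≡ [ y ]· q
  []·-cong-⇔ to from (yes p) y q = sym ([]·-yes (to p) y q)
  []·-cong-⇔ to from (no ¬p) y q = sym ([]·-no (λ z → ¬p (from z)) y q)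

  []·-comm : (x : Dec P) (y : Dec Q) (q : ℚ) → [ x ]· [ y ]· q ≡ [ y ]· [ x ]· q
  []·-comm (yes _) (yes _) q = refl
  []·-comm (yes _) (no _)  q = refl
  []·-comm (no _)  (yes _) q = refl
  []·-comm (no _)  (no _)  q = refl

  []·-zero : (x : Dec P) → [ x ]· 0ℚ ≡ 0ℚ
  []·-zero (yes _) = refl
  []·-zero (no _)  = refl

  []·-+ : (x : Dec P) (p q : ℚ) → [ x ]· (p + q) ≡ [ x ]· p + [ x ]· q
  []·-+ (yes _) p q = refl
  []·-+ (no _)  p q = refl

  []·-neg : (x : Dec P) (q : ℚ) → [ x ]· (- q) ≡ - [ x ]· q
  []·-neg (yes _) q = refl
  []·-neg (no _)  q = refl

  []·-nonNeg : (x : Dec P) {q : ℚ} → 0ℚ ≤ q → 0ℚ ≤ [ x ]· q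
  []·-nonNeg (yes _) 0≤q = 0≤q
  []·-nonNeg (no _)  0≤q = ℚ.≤-refl

  []·-¬? : (x : Dec P) (q : ℚ) → [ ¬? x ]· q ≡ q - [ x ]· q
  []·-¬? (yes _) q = sym (+-inverseʳ q)
  []·-¬? (no _)  q = sym (+-identityʳ q)

  []·-sum : (x : Dec P) {n : ℕ} (g : Fin n → ℚ) → [ x ]· sum g ≡ ∑[ i < n ] [ x ]· g i
  []·-sum (yes _) g = refl
  []·-sum (no _) {n} g = sym (sum-replicate-zero n)

  ∑-neg : ∀ n (g : Fin n → ℚ) → ∑[ i < n ] (- g i) ≡ - sum g
  ∑-neg zero    g = refl
  ∑-neg (suc n) g = trans (cong (- g zero +_) (∑-neg n (λ i → g (suc i))))
                          (sym (neg-distrib-+ (g zero) _))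

  ∑-distrib-sub : ∀ n (g h : Fin n → ℚ) → ∑[ i < n ] (g i - h i) ≡ sum g - sum h
  ∑-distrib-sub n g h = trans (∑-distrib-+ g (λ i → - h i)) (cong (sum g +_) (∑-neg n h))

  ∑-mono-≤ : ∀ n {g h : Fin n → ℚ} → (∀ i → g i ≤ h i) → sum g ≤ sum h
  ∑-mono-≤ zero    g≤h = ℚ.≤-refl
  ∑-mono-≤ (suc n) g≤h = +-mono-≤ (g≤h zero) (∑-mono-≤ n (λ i → g≤h (suc i)))

  ∑-mono-< : ∀ n {g h : Fin n → ℚ} → (∀ i → g i ≤ h i) → ∀ j → g j < h j → sum g < sum h
  ∑-mono-< (suc n) g≤h zero    gj<hj = +-mono-<-≤ gj<hj (∑-mono-≤ n (λ i → g≤h (suc i)))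
  ∑-mono-< (suc n) g≤h (suc j) gj<hj =
    +-mono-≤-< (g≤h zero) (∑-mono-< n (λ i → g≤h (suc i)) j gj<hj)

  ∑-[≟]· : ∀ n (j : Fin n) (h : Fin n → ℚ) → ∑[ i < n ] [ j ≟ i ]· h i ≡ h j
  ∑-[≟]· (suc n) zero    h = trans (cong (h zero +_) (sum-replicate-zero n)) (+-identityʳ (h zero))
  ∑-[≟]· (suc n) (suc j) h = begin
    0ℚ + ∑[ i < n ] [ suc j ≟ suc i ]· h (suc i)
      ≡⟨ +-identityˡ _ ⟩
    ∑[ i < n ] [ suc j ≟ suc i ]· h (suc i)
      ≡⟨ sum-cong-≗ (λ i → []·-cong-⇔ suc-injective (cong suc) (suc j ≟ suc i) (j ≟ i) _) ⟩
    ∑[ i < n ] [ j ≟ i ]· h (suc i)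
      ≡⟨ ∑-[≟]· n j (λ i → h (suc i)) ⟩
    h (suc j) ∎
    where open ≡-Reasoning

  0<p-q⇒q<p : ∀ {p q} → 0ℚ < p - q → q < p
  0<p-q⇒q<p {p} {q} 0<p-q =
    subst₂ _<_ (+-identityˡ q) (solve 2 (λ p q → (p :- q) :+ q := p) refl p q) (ℚ.+-monoˡ-< q 0<p-q)

  q≤p⇒0≤p-q : ∀ {p q} → q ≤ p → 0ℚ ≤ p - q
  q≤p⇒0≤p-q {p} {q} q≤p = subst (_≤ p - q) (+-inverseʳ q) (ℚ.+-monoˡ-≤ (- q) q≤p)

  p≡-p⇒p≡0 : ∀ {p} → p ≡ - p → p ≡ 0ℚ
  p≡-p⇒p≡0 {p} p≡-p with ℚ.<-cmp p 0ℚ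
  ... | tri≈ _ p≡0 _ = p≡0
  ... | tri< p<0 _ _ = contradiction (subst (0ℚ <_) (sym p≡-p) (ℚ.neg-antimono-< p<0)) (ℚ.<-asym p<0)
  ... | tri> _ _ p>0 = contradiction (subst (_< 0ℚ) (sym p≡-p) (ℚ.neg-antimono-< p>0)) (ℚ.<-asym p>0)

module FlowTheory (M : CombMap) where

  open CombMap M
  open Flows M
  open RationalSums

  open import Data.Fin using (Fin; zero; suc; _≟_)
  open import Data.Fin.Permutation using (permutation)
  open import Data.Fin.Properties using (sequence)
  open import Data.List.Base using (List; []; _∷_; map; _++_; [_])
  open import Data.List.Membership.DecPropositional (_≟_ {D}) using () renaming (_∈?_ to _∈ᴰ?_)
  open import Data.List.Membership.DecPropositional (_≟_ {V}) using () renaming (_∈?_ to _∈ⱽ?_)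
  open import Data.List.Membership.Propositional using (_∈_; _∉_)
  open import Data.List.Relation.Unary.All as All using (All; []; _∷_)
  open import Data.List.Relation.Unary.All.Properties using (++⁺; ¬Any⇒All¬; All¬⇒¬Any)
  open import Data.List.Relation.Unary.AllPairs using ([]; _∷_)
  open import Data.List.Relation.Unary.Any using (here; there)
  open import Data.List.Relation.Unary.Unique.Propositional using (Unique)
  open import Data.List.Relation.Unary.Unique.Propositional.Properties using (map⁻)
  open import Data.Nat.Base using (zero; suc)
  open import Data.Product using (∃; _×_; _,_; proj₁; proj₂)
  open import Data.Rational using (ℚ; 0ℚ; 1ℚ; _+_; _-_; -_; _≤_; _<_; _⊓_)
  open import Data.Rational.Properties as ℚ
    using (+-identityˡ; +-identityʳ; +-inverseʳ; neg-distrib-+; ≤-refl; ≤-reflexive; ≤-trans; <-≤-trans)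
  open import Data.Rational.Solver using (module +-*-Solver)
  open import Algebra.Properties.Group ℚ.+-0-group using (inverseˡ-unique)
  open import Data.Sum using (_⊎_; inj₁; inj₂; [_,_]′)
  open import Data.Unit using (tt)
  open import Effect.Monad using (RawMonad)
  open import Function using (_∘_)
  open import Level using (0ℓ)
  open import Relation.Binary.PropositionalEquality hiding ([_])
  open import Relation.Nullary using (¬_; Dec; yes; no; ¬?; contradiction)
  open import Relation.Nullary.Decidable using (¬¬-excluded-middle)
  open import Relation.Nullary.Negation using (¬¬-Monad)
  open import Relation.Unary using (Pred; Decidable)
  open +-*-Solver

  Antisymmetric : Cap → Set
  Antisymmetric f = ∀ d → f (rev d) ≡ - f d

  rev-injective : ∀ {d e} → rev d ≡ rev e → d ≡ e
  rev-injective {d} {e} eq = trans (sym (rev-invol d)) (trans (cong rev eq) (rev-invol e))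

  head-rev : ∀ d → head (rev d) ≡ tail d
  head-rev d = cong tail (rev-invol d)

  sumFin≡sum : ∀ n (g : Fin n → ℚ) → sumFin n g ≡ sum g
  sumFin≡sum zero    g = refl
  sumFin≡sum (suc n) g = cong (g zero +_) (sumFin≡sum n (λ i → g (suc i)))

  -- The summand of inflow is built from a helper local to its where block; it
  -- cannot be named, so the left side is fixed by unification with the use below.
  inflow-summand : ∀ f v d → _ ≡ [ head d ≟ v ]· f d

  inflow≡∑ : ∀ f v → inflow f v ≡ ∑[ d < D ] [ head d ≟ v ]· f d
  inflow≡∑ f v = trans (sumFin≡sum D _) (sum-cong-≗ (inflow-summand f v))

  inflow-summand f v d with head d ≟ v
  ... | yes _ = refl
  ... | no  _ = refl

  inflow-zero : ∀ v → inflow (λ _ → 0ℚ) v ≡ 0ℚ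
  inflow-zero v = trans (inflow≡∑ _ v)
    (trans (sum-cong-≗ (λ d → []·-zero (head d ≟ v))) (sum-replicate-zero D))

  inflow-+ : ∀ f g v → inflow (λ d → f d + g d) v ≡ inflow f v + inflow g v
  inflow-+ f g v = begin
    inflow (λ d → f d + g d) v
      ≡⟨ inflow≡∑ _ v ⟩
    ∑[ d < D ] [ head d ≟ v ]· (f d + g d)
      ≡⟨ sum-cong-≗ (λ d → []·-+ (head d ≟ v) (f d) (g d)) ⟩
    ∑[ d < D ] ([ head d ≟ v ]· f d + [ head d ≟ v ]· g d)
      ≡⟨ ∑-distrib-+ (λ d → [ head d ≟ v ]· f d) (λ d → [ head d ≟ v ]· g d) ⟩
    ∑[ d < D ] [ head d ≟ v ]· f d + ∑[ d < D ] [ head d ≟ v ]· g d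
      ≡⟨ cong₂ _+_ (inflow≡∑ f v) (inflow≡∑ g v) ⟨
    inflow f v + inflow g v ∎
    where open ≡-Reasoning

  inflow-neg : ∀ f v → inflow (λ d → - f d) v ≡ - inflow f v
  inflow-neg f v = begin
    inflow (λ d → - f d) v
      ≡⟨ inflow≡∑ _ v ⟩
    ∑[ d < D ] [ head d ≟ v ]· (- f d)
      ≡⟨ sum-cong-≗ (λ d → []·-neg (head d ≟ v) (f d)) ⟩
    ∑[ d < D ] (- [ head d ≟ v ]· f d)
      ≡⟨ ∑-neg D _ ⟩
    - ∑[ d < D ] [ head d ≟ v ]· f d
      ≡⟨ cong -_ (inflow≡∑ f v) ⟨
    - inflow f v ∎
    where open ≡-Reasoning

  inflow-sub : ∀ f g v → inflow (λ d → f d - g d) v ≡ inflow f v - inflow g v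
  inflow-sub f g v = trans (inflow-+ f (λ d → - g d) v) (cong (inflow f v +_) (inflow-neg g v))

  inflow-[≟] : ∀ e q v → inflow (λ d → [ e ≟ d ]· q) v ≡ [ head e ≟ v ]· q
  inflow-[≟] e q v = begin
    inflow (λ d → [ e ≟ d ]· q) v
      ≡⟨ inflow≡∑ _ v ⟩
    ∑[ d < D ] [ head d ≟ v ]· [ e ≟ d ]· q
      ≡⟨ sum-cong-≗ (λ d → []·-comm (head d ≟ v) (e ≟ d) q) ⟩
    ∑[ d < D ] [ e ≟ d ]· [ head d ≟ v ]· q
      ≡⟨ ∑-[≟]· D e (λ d → [ head d ≟ v ]· q) ⟩
    [ head e ≟ v ]· q ∎
    where open ≡-Reasoning

  ∑-rev : ∀ (g : Fin D → ℚ) → ∑[ d < D ] g (rev d) ≡ sum g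
  ∑-rev g = sym (∑-permute g (permutation rev rev rev-invol rev-invol))

  ∑-antisymmetric : ∀ {f} → Antisymmetric f → sum f ≡ 0ℚ
  ∑-antisymmetric {f} anti =
    p≡-p⇒p≡0 (trans (sym (∑-rev f)) (trans (sum-cong-≗ anti) (∑-neg D f)))

  Leaves : Pred (Fin V) 0ℓ → Fin D → Set
  Leaves A d = A (tail d) × ¬ A (head d)

  module _ {A : Pred (Fin V) 0ℓ} (A? : Decidable A) where

    inflowInto : Cap → ℚ
    inflowInto f = ∑[ v < V ] [ A? v ]· inflow f v

    inflowInto≡∑ : ∀ f → inflowInto f ≡ ∑[ d < D ] [ A? (head d) ]· f d
    inflowInto≡∑ f = begin
      ∑[ v < V ] [ A? v ]· inflow f v
        ≡⟨ sum-cong-≗ (λ v → trans (cong [ A? v ]·_ (inflow≡∑ f v)) ([]·-sum (A? v) {D} _)) ⟩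
      ∑[ v < V ] ∑[ d < D ] [ A? v ]· [ head d ≟ v ]· f d
        ≡⟨ ∑-comm {V} {D} _ ⟩
      ∑[ d < D ] ∑[ v < V ] [ A? v ]· [ head d ≟ v ]· f d
        ≡⟨ sum-cong-≗ (λ d → sum-cong-≗ (λ v → []·-comm (A? v) (head d ≟ v) (f d))) ⟩
      ∑[ d < D ] ∑[ v < V ] [ head d ≟ v ]· [ A? v ]· f d
        ≡⟨ sum-cong-≗ (λ d → ∑-[≟]· V (head d) (λ v → [ A? v ]· f d)) ⟩
      ∑[ d < D ] [ A? (head d) ]· f d ∎
      where open ≡-Reasoning

    outflowFrom≡-inflowInto : ∀ {f} → Antisymmetric f →
                              ∑[ d < D ] [ A? (tail d) ]· f d ≡ - inflowInto f
    outflowFrom≡-inflowInto {f} anti = begin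
      ∑[ d < D ] [ A? (tail d) ]· f d
        ≡⟨ ∑-rev _ ⟨
      ∑[ d < D ] [ A? (head d) ]· f (rev d)
        ≡⟨ sum-cong-≗ (λ d → trans (cong [ A? (head d) ]·_ (anti d)) ([]·-neg (A? (head d)) (f d))) ⟩
      ∑[ d < D ] (- [ A? (head d) ]· f d)
        ≡⟨ ∑-neg D _ ⟩
      - ∑[ d < D ] [ A? (head d) ]· f d
        ≡⟨ cong -_ (inflowInto≡∑ f) ⟨
      - inflowInto f ∎
      where open ≡-Reasoning

    -- Over all darts, [tail ∈ A] f - [head ∈ A] f sums to -2·inflowInto f, and each term is
    -- ≤ 0 because a dart entering A is the reverse of one leaving it.
    inflowInto-positive : ∀ {f} → Antisymmetric f → (∀ d → Leaves A d → f d ≤ 0ℚ) →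
                          ∀ e → Leaves A e → f e < 0ℚ → 0ℚ < inflowInto f
    inflowInto-positive {f} anti leaving≤0 e e-leaves fe<0 = ℚ.≰⇒> X≰0
      where
      X : ℚ
      X = inflowInto f

      net : Fin D → ℚ
      net d = [ A? (tail d) ]· f d - [ A? (head d) ]· f d

      net≤0 : ∀ d → net d ≤ 0ℚ
      net≤0 d with A? (tail d) | A? (head d)
      ... | yes _  | yes _  = ≤-reflexive (+-inverseʳ (f d))
      ... | yes tA | no ¬hA = subst (_≤ 0ℚ) (sym (+-identityʳ (f d))) (leaving≤0 d (tA , ¬hA))
      ... | no ¬tA | yes hA = subst (_≤ 0ℚ) (trans (anti d) (sym (+-identityˡ (- f d))))
                                    (leaving≤0 (rev d) (hA , λ A-hrd → ¬tA (subst A (head-rev d) A-hrd)))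
      ... | no _   | no _   = ≤-refl

      net<0 : net e < 0ℚ
      net<0 with A? (tail e) | A? (head e)
      ... | yes _  | no _   = subst (_< 0ℚ) (sym (+-identityʳ (f e))) fe<0
      ... | yes _  | yes hA = contradiction hA (proj₂ e-leaves)
      ... | no ¬tA | _      = contradiction (proj₁ e-leaves) ¬tA

      ∑net≡ : sum net ≡ - X - X
      ∑net≡ = trans (∑-distrib-sub D _ _)
                    (cong₂ _-_ (outflowFrom≡-inflowInto anti) (sym (inflowInto≡∑ f)))

      X≰0 : ¬ X ≤ 0ℚ
      X≰0 X≤0 = ℚ.<-irrefl refl (<-≤-trans ∑net<0 0≤∑net)
        where
        ∑net<0 : sum net < 0ℚ
        ∑net<0 = subst (sum net <_) (sum-replicate-zero D) (∑-mono-< D net≤0 e net<0)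
        0≤∑net : 0ℚ ≤ sum net
        0≤∑net = subst (0ℚ ≤_) (sym ∑net≡)
                   (ℚ.+-mono-≤ (ℚ.neg-antimono-≤ X≤0) (ℚ.neg-antimono-≤ X≤0))

  ∑-inflow : ∀ {f} → Antisymmetric f → ∑[ v < V ] inflow f v ≡ 0ℚ
  ∑-inflow {f} anti = trans (inflowInto≡∑ (λ _ → yes tt) f) (∑-antisymmetric anti)

  inflowInto-¬ : ∀ {A} (A? : Decidable A) {f} → Antisymmetric f →
                 inflowInto (λ v → ¬? (A? v)) f ≡ - inflowInto A? f
  inflowInto-¬ A? {f} anti = begin
    ∑[ v < V ] [ ¬? (A? v) ]· inflow f v
      ≡⟨ sum-cong-≗ (λ v → []·-¬? (A? v) (inflow f v)) ⟩
    ∑[ v < V ] (inflow f v - [ A? v ]· inflow f v)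
      ≡⟨ ∑-distrib-sub V _ _ ⟩
    ∑[ v < V ] inflow f v - inflowInto A? f
      ≡⟨ cong (_- inflowInto A? f) (∑-inflow anti) ⟩
    0ℚ - inflowInto A? f
      ≡⟨ +-identityˡ _ ⟩
    - inflowInto A? f ∎
    where open ≡-Reasoning

  ResidualWalk : Cap → Fin V → Fin V → Set
  ResidualWalk c u w = ∃ λ ds → Walk M u w ds × Residual c ds

  module _ {c : Cap} where

    residualWalk-refl : ∀ {u} → ResidualWalk c u u
    residualWalk-refl = [] , [] , []

    residualWalk-cons : ∀ {d w} → 0ℚ < c d → ResidualWalk c (head d) w → ResidualWalk c (tail d) w
    residualWalk-cons {d} 0<cd (ds , walk , res) = d ∷ ds , step refl walk , 0<cd ∷ res

    residualWalk-snoc : ∀ {u d} → ResidualWalk c u (tail d) → 0ℚ < c d → ResidualWalk c u (head d)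
    residualWalk-snoc {d = d} (ds , walk , res) 0<cd = ds ++ [ d ] , walk-snoc walk , ++⁺ res (0<cd ∷ [])
      where
      walk-snoc : ∀ {u ds} → Walk M u (tail d) ds → Walk M u (head d) (ds ++ [ d ])
      walk-snoc []                = step refl []
      walk-snoc (step tail≡ walk) = step tail≡ (walk-snoc walk)

    residualWalk-cong : ∀ {c′ u w} → (∀ d → c d ≡ c′ d) →
                        ResidualWalk c u w → ResidualWalk c′ u w
    residualWalk-cong c≗c′ (ds , walk , res) =
      ds , walk , All.map (λ {d} → subst (0ℚ <_) (c≗c′ d)) res

    residualPath⇒residualWalk : ∀ {u w} → ResidualPath c u w → ResidualWalk c u w
    residualPath⇒residualWalk (ds , (walk , _) , res) = ds , walk , res

    residualPath-suffix : ∀ {u x w es} → Walk M x w es → Unique (x ∷ map head es) → Residual c es →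
                          u ∈ (x ∷ map head es) → ResidualPath c u w
    residualPath-suffix {es = es} walk uniq res (here refl) = es , (walk , uniq) , res
    residualPath-suffix (step _ walk) (_ ∷ uniq) (_ ∷ res) (there u∈) =
      residualPath-suffix walk uniq res u∈

    residualWalk⇒residualPath : ∀ {u w} → ResidualWalk c u w → ResidualPath c u w
    residualWalk⇒residualPath (_ , walk , res) = shortcut walk res
      where
      shortcut : ∀ {u w ds} → Walk M u w ds → Residual c ds → ResidualPath c u w
      shortcut []                  []           = [] , ([] , [] ∷ []) , []
      shortcut {u} (step {d = d} tail≡ walk) (0<cd ∷ res) with shortcut walk res
      ... | es , (walk′ , uniq) , res′ with u ∈ⱽ? (head d ∷ map head es)
      ...   | yes u∈ = residualPath-suffix walk′ uniq res′ u∈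
      ...   | no  u∉ = d ∷ es , (step tail≡ walk′ , ¬Any⇒All¬ _ u∉ ∷ uniq) , 0<cd ∷ res′

    residualWalk-exit : ∀ {A : Pred (Fin V) 0ℓ} → Decidable A → ∀ {u w} → ResidualWalk c u w →
                        A u → ¬ A w → ∃ λ e → Leaves A e × 0ℚ < c e
    residualWalk-exit {A} A? (_ , walk , res) = exit walk res
      where
      exit : ∀ {u w ds} → Walk M u w ds → Residual c ds → A u → ¬ A w →
             ∃ λ e → Leaves A e × 0ℚ < c e
      exit []                          []           Au ¬Aw = contradiction Au ¬Aw
      exit (step {d = d} tail≡ walk) (0<cd ∷ res) Au ¬Aw with A? (head d)
      ... | yes Ahd = exit walk res Ahd ¬Aw
      ... | no ¬Ahd = d , (subst A (sym tail≡) Au , ¬Ahd) , 0<cd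

  residualCap-nonNeg : ∀ {c f c′} → (∀ d → f d ≤ c d) → (∀ d → c′ d ≡ residualCap c f d) →
                       NonNeg c′
  residualCap-nonNeg f≤c c′≗ d = subst (0ℚ ≤_) (sym (c′≗ d)) (q≤p⇒0≤p-q (f≤c d))

  cut⇒¬residualWalk : ∀ {A : Pred (Fin V) 0ℓ} (A? : Decidable A) {c f a b} →
    Antisymmetric f → (∀ d → f d ≤ c d) → (∀ d → Leaves A d → c d ≤ 0ℚ) →
    inflowInto A? f ≤ 0ℚ → A a → ¬ A b → ¬ ResidualWalk (residualCap c f) a b
  cut⇒¬residualWalk {A} A? {c} {f} anti f≤c leaving≤0 inflow≤0 Aa ¬Ab walk
    with residualWalk-exit A? walk Aa ¬Ab
  ... | e , e-leaves , 0<c-f =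
    ℚ.<-irrefl refl (<-≤-trans (inflowInto-positive A? anti f≤0 e e-leaves fe<0) inflow≤0)
    where
    f≤0 : ∀ d → Leaves A d → f d ≤ 0ℚ
    f≤0 d d-leaves = ≤-trans (f≤c d) (leaving≤0 d d-leaves)
    fe<0 : f e < 0ℚ
    fe<0 = <-≤-trans (0<p-q⇒q<p 0<c-f) (leaving≤0 e e-leaves)

  -- Reachability sets are not decidable constructively; as every use has goal ⊥,
  -- double-negated decidability suffices.
  ¬¬-decidable : (P : Pred (Fin V) 0ℓ) → ¬ ¬ Decidable P
  ¬¬-decidable P = sequence (RawMonad.rawApplicative ¬¬-Monad) (λ _ → ¬¬-excluded-middle)

  residual-lowerBound : ∀ {c es} → Residual c es → ∃ λ ε → 0ℚ < ε × All (λ d → ε ≤ c d) es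
  residual-lowerBound []             = 1ℚ , ℚ.positive⁻¹ 1ℚ , []
  residual-lowerBound {c} {e ∷ _} (0<ce ∷ res) with residual-lowerBound res
  ... | ε , 0<ε , ε≤ =
    c e ⊓ ε , ⊓-positive , ℚ.p⊓q≤p (c e) ε ∷ All.map (≤-trans (ℚ.p⊓q≤q (c e) ε)) ε≤
    where
    ⊓-positive : 0ℚ < c e ⊓ ε
    ⊓-positive = [ (λ ≡ce → subst (0ℚ <_) (sym ≡ce) 0<ce) , (λ ≡ε → subst (0ℚ <_) (sym ≡ε) 0<ε) ]′
                   (ℚ.⊓-sel (c e) ε)

  module PathFlow (ε : ℚ) where

    unitFlow : Fin D → Cap
    unitFlow e d = [ e ≟ d ]· ε - [ rev e ≟ d ]· ε

    pathFlow : List (Fin D) → Cap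
    pathFlow []       d = 0ℚ
    pathFlow (e ∷ es) d = unitFlow e d + pathFlow es d

    unitFlow-antisymmetric : ∀ e → Antisymmetric (unitFlow e)
    unitFlow-antisymmetric e d = begin
      [ e ≟ rev d ]· ε - [ rev e ≟ rev d ]· ε
        ≡⟨ cong₂ _-_ ([]·-cong-⇔ e≡rd⇒re≡d re≡d⇒e≡rd (e ≟ rev d) (rev e ≟ d) ε)
                     ([]·-cong-⇔ rev-injective (cong rev) (rev e ≟ rev d) (e ≟ d) ε) ⟩
      [ rev e ≟ d ]· ε - [ e ≟ d ]· ε
        ≡⟨ solve 2 (λ p q → q :- p := :- (p :- q)) refl ([ e ≟ d ]· ε) ([ rev e ≟ d ]· ε) ⟩
      - ([ e ≟ d ]· ε - [ rev e ≟ d ]· ε) ∎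
      where
      open ≡-Reasoning
      e≡rd⇒re≡d : e ≡ rev d → rev e ≡ d
      e≡rd⇒re≡d e≡rd = trans (cong rev e≡rd) (rev-invol d)
      re≡d⇒e≡rd : rev e ≡ d → e ≡ rev d
      re≡d⇒e≡rd re≡d = trans (sym (rev-invol e)) (cong rev re≡d)

    pathFlow-antisymmetric : ∀ es → Antisymmetric (pathFlow es)
    pathFlow-antisymmetric []       d = refl
    pathFlow-antisymmetric (e ∷ es) d =
      trans (cong₂ _+_ (unitFlow-antisymmetric e d) (pathFlow-antisymmetric es d))
            (sym (neg-distrib-+ (unitFlow e d) (pathFlow es d)))

    inflow-unitFlow : ∀ e v → inflow (unitFlow e) v ≡ [ head e ≟ v ]· ε - [ tail e ≟ v ]· ε
    inflow-unitFlow e v = trans (inflow-sub (λ d → [ e ≟ d ]· ε) (λ d → [ rev e ≟ d ]· ε) v)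
      (cong₂ _-_ (inflow-[≟] e ε v)
                 (trans (inflow-[≟] (rev e) ε v) (cong (λ x → [ x ≟ v ]· ε) (head-rev e))))

    inflow-pathFlow : ∀ {u w es} → Walk M u w es → ∀ v →
                      inflow (pathFlow es) v ≡ [ w ≟ v ]· ε - [ u ≟ v ]· ε
    inflow-pathFlow {u} [] v = trans (inflow-zero v) (sym (+-inverseʳ ([ u ≟ v ]· ε)))
    inflow-pathFlow {u} {w} (step {d = e} {ds = es} tail≡u walk) v = begin
      inflow (λ d → unitFlow e d + pathFlow es d) v
        ≡⟨ inflow-+ (unitFlow e) (pathFlow es) v ⟩
      inflow (unitFlow e) v + inflow (pathFlow es) v
        ≡⟨ cong₂ _+_ (inflow-unitFlow e v) (inflow-pathFlow walk v) ⟩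
      ([ head e ≟ v ]· ε - [ tail e ≟ v ]· ε) + ([ w ≟ v ]· ε - [ head e ≟ v ]· ε)
        ≡⟨ cong (λ x → ([ head e ≟ v ]· ε - [ x ≟ v ]· ε) + _) tail≡u ⟩
      ([ head e ≟ v ]· ε - [ u ≟ v ]· ε) + ([ w ≟ v ]· ε - [ head e ≟ v ]· ε)
        ≡⟨ solve 3 (λ h u w → (h :- u) :+ (w :- h) := w :- u) refl
                 ([ head e ≟ v ]· ε) ([ u ≟ v ]· ε) ([ w ≟ v ]· ε) ⟩
      [ w ≟ v ]· ε - [ u ≟ v ]· ε ∎
      where open ≡-Reasoning

    module _ (0≤ε : 0ℚ ≤ ε) where

      unitFlow-≤ : ∀ e d → unitFlow e d ≤ [ e ≟ d ]· ε
      unitFlow-≤ e d = subst (unitFlow e d ≤_) (+-identityʳ _)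
        (ℚ.+-monoʳ-≤ ([ e ≟ d ]· ε) (ℚ.neg-antimono-≤ ([]·-nonNeg (rev e ≟ d) 0≤ε)))

      pathFlow-nonPos : ∀ {es d} → d ∉ es → pathFlow es d ≤ 0ℚ
      pathFlow-nonPos {[]}     d∉ = ≤-refl
      pathFlow-nonPos {e ∷ es} {d} d∉ = ℚ.+-mono-≤
        (≤-trans (unitFlow-≤ e d) (≤-reflexive ([]·-no (d∉ ∘ here ∘ sym) (e ≟ d) ε)))
        (pathFlow-nonPos (d∉ ∘ there))

      pathFlow-≤ε : ∀ {es} → Unique es → ∀ d → pathFlow es d ≤ ε
      pathFlow-≤ε {[]}     _               d = 0≤ε
      pathFlow-≤ε {e ∷ es} (e∉es ∷ uniq) d = bound d (e ≟ d)
        where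
        bound : ∀ d → Dec (e ≡ d) → unitFlow e d + pathFlow es d ≤ ε
        bound d (yes refl) = subst (unitFlow e e + pathFlow es e ≤_) (+-identityʳ ε) (ℚ.+-mono-≤
          (≤-trans (unitFlow-≤ e e) (≤-reflexive ([]·-yes refl (e ≟ e) ε)))
          (pathFlow-nonPos (All¬⇒¬Any e∉es)))
        bound d (no e≢d) = subst (unitFlow e d + pathFlow es d ≤_) (+-identityˡ ε) (ℚ.+-mono-≤
          (≤-trans (unitFlow-≤ e d) (≤-reflexive ([]·-no e≢d (e ≟ d) ε)))
          (pathFlow-≤ε uniq d))

  module STFlow {c : Cap} {s t : Fin V} {f : Cap} (flow : IsFlowST c s t f) where

    anti : Antisymmetric f
    anti = proj₁ flow

    f≤c : ∀ d → f d ≤ c d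
    f≤c = proj₁ (proj₂ flow)

    balanced : ∀ {v} → v ≢ s → v ≢ t → inflow f v ≡ 0ℚ
    balanced v≢s v≢t = proj₂ (proj₂ flow) _ [ v≢s , v≢t ]′

    inflow-source≡-sink : s ≢ t → inflow f s ≡ - inflow f t
    inflow-source≡-sink s≢t = inverseˡ-unique (inflow f s) (inflow f t) (begin
      inflow f s + inflow f t
        ≡⟨ cong₂ _+_ (∑-[≟]· V s (λ _ → inflow f s)) (∑-[≟]· V t (λ _ → inflow f t)) ⟨
      ∑[ v < V ] [ s ≟ v ]· inflow f s + ∑[ v < V ] [ t ≟ v ]· inflow f t
        ≡⟨ ∑-distrib-+ (λ v → [ s ≟ v ]· inflow f s) (λ v → [ t ≟ v ]· inflow f t) ⟨
      ∑[ v < V ] ([ s ≟ v ]· inflow f s + [ t ≟ v ]· inflow f t)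
        ≡⟨ sum-cong-≗ terminal-terms ⟨
      ∑[ v < V ] inflow f v
        ≡⟨ ∑-inflow anti ⟩
      0ℚ ∎)
      where
      open ≡-Reasoning
      terminal-terms : ∀ v → inflow f v ≡ [ s ≟ v ]· inflow f s + [ t ≟ v ]· inflow f t
      terminal-terms v with s ≟ v | t ≟ v
      ... | yes refl | yes refl = contradiction refl s≢t
      ... | yes refl | no _     = sym (+-identityʳ _)
      ... | no _     | yes refl = sym (+-identityˡ _)
      ... | no s≢v   | no t≢v   = balanced (s≢v ∘ sym) (t≢v ∘ sym)

    inflowInto-nonPos : ∀ {A} (A? : Decidable A) → (∀ {v} → A v → v ≢ t) →
                        inflow f s ≤ 0ℚ → inflowInto A? f ≤ 0ℚ
    inflowInto-nonPos A? A∌t s≤0 =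
      subst (inflowInto A? f ≤_) (sum-replicate-zero V) (∑-mono-≤ V term≤0)
      where
      term≤0 : ∀ v → [ A? v ]· inflow f v ≤ 0ℚ
      term≤0 v with A? v
      ... | no _ = ≤-refl
      ... | yes Av with v ≟ s
      ...   | yes refl = s≤0
      ...   | no v≢s   = ≤-reflexive (balanced v≢s (A∌t Av))

    inflowInto-nonNeg : ∀ {A} (A? : Decidable A) → (∀ {v} → A v → v ≢ s) →
                        0ℚ ≤ inflow f t → 0ℚ ≤ inflowInto A? f
    inflowInto-nonNeg A? A∌s 0≤t =
      subst (_≤ inflowInto A? f) (sum-replicate-zero V) (∑-mono-≤ V 0≤term)
      where
      0≤term : ∀ v → 0ℚ ≤ [ A? v ]· inflow f v
      0≤term v with A? v
      ... | no _ = ≤-refl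
      ... | yes Av with v ≟ t
      ...   | yes refl = 0≤t
      ...   | no v≢t   = ≤-reflexive (sym (balanced (A∌s Av) v≢t))

    unreachable-from : ∀ {a b} → inflow f s ≤ 0ℚ → ¬ ResidualWalk c a b → ¬ ResidualWalk c a t →
                       ¬ ResidualWalk (residualCap c f) a b
    unreachable-from {a} s≤0 ¬a⇝b ¬a⇝t walk = ¬¬-decidable (ResidualWalk c a) λ reach? →
      cut⇒¬residualWalk reach? anti f≤c
        (λ d (a⇝tail , ¬a⇝head) → ℚ.≮⇒≥ (λ 0<cd → ¬a⇝head (residualWalk-snoc a⇝tail 0<cd)))
        (inflowInto-nonPos reach? (λ a⇝v v≡t → ¬a⇝t (subst (ResidualWalk c a) v≡t a⇝v)) s≤0)
        residualWalk-refl ¬a⇝b walk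

    unreachable-to : ∀ {a b} → 0ℚ ≤ inflow f t → ¬ ResidualWalk c a b → ¬ ResidualWalk c s b →
                     ¬ ResidualWalk (residualCap c f) a b
    unreachable-to {b = b} 0≤t ¬a⇝b ¬s⇝b walk = ¬¬-decidable (λ v → ResidualWalk c v b) λ reach? →
      cut⇒¬residualWalk (λ v → ¬? (reach? v)) anti f≤c
        (λ d (¬tail⇝b , ¬¬head⇝b) →
           ℚ.≮⇒≥ (λ 0<cd → ¬¬head⇝b (¬tail⇝b ∘ residualWalk-cons 0<cd)))
        (subst (_≤ 0ℚ) (sym (inflowInto-¬ reach? anti)) (ℚ.neg-antimono-≤ (inflowInto-nonNeg reach?
          (λ v⇝b v≡s → ¬s⇝b (subst (λ x → ResidualWalk c x b) v≡s v⇝b)) 0≤t)))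
        ¬a⇝b (λ ¬b⇝b → ¬b⇝b residualWalk-refl) walk

    augment : s ≢ t → ResidualPath (residualCap c f) s t →
              ∃ λ g → IsFlowST c s t g × inflow f t < inflow g t
    augment s≢t (es , (walk , _ ∷ heads-unique) , res) with residual-lowerBound res
    ... | ε , 0<ε , ε≤res = g , (g-anti , g≤c , g-balanced) , value-increases
      where
      open PathFlow ε
      0≤ε : 0ℚ ≤ ε
      0≤ε = ℚ.<⇒≤ 0<ε
      g : Cap
      g d = f d + pathFlow es d

      g-anti : Antisymmetric g
      g-anti d = trans (cong₂ _+_ (anti d) (pathFlow-antisymmetric es d)) (sym (neg-distrib-+ (f d) _))

      g≤c : ∀ d → g d ≤ c d
      g≤c d with d ∈ᴰ? es
      ... | yes d∈ = subst (g d ≤_) (solve 2 (λ c f → f :+ (c :- f) := c) refl (c d) (f d))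
        (ℚ.+-monoʳ-≤ (f d) (≤-trans (pathFlow-≤ε 0≤ε (map⁻ heads-unique) d) (All.lookup ε≤res d∈)))
      ... | no  d∉ = ≤-trans
        (subst (g d ≤_) (+-identityʳ (f d)) (ℚ.+-monoʳ-≤ (f d) (pathFlow-nonPos 0≤ε d∉)))
        (f≤c d)

      inflow-g : ∀ v → inflow g v ≡ inflow f v + ([ t ≟ v ]· ε - [ s ≟ v ]· ε)
      inflow-g v = trans (inflow-+ f (pathFlow es) v) (cong (inflow f v +_) (inflow-pathFlow walk v))

      g-balanced : ∀ v → ¬ (v ≡ s ⊎ v ≡ t) → inflow g v ≡ 0ℚ
      g-balanced v ¬terminal = trans (inflow-g v) (cong₂ _+_
        (balanced (¬terminal ∘ inj₁) (¬terminal ∘ inj₂))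
        (cong₂ _-_ ([]·-no (¬terminal ∘ inj₂ ∘ sym) (t ≟ v) ε)
                   ([]·-no (¬terminal ∘ inj₁ ∘ sym) (s ≟ v) ε)))

      value-increases : inflow f t < inflow g t
      value-increases = subst (inflow f t <_) (sym (trans (inflow-g t) (cong (inflow f t +_) t-term)))
        (subst (_< inflow f t + ε) (+-identityʳ (inflow f t)) (ℚ.+-monoʳ-< (inflow f t) 0<ε))
        where
        t-term : [ t ≟ t ]· ε - [ s ≟ t ]· ε ≡ ε
        t-term = trans (cong₂ _-_ ([]·-yes refl (t ≟ t) ε) ([]·-no s≢t (s ≟ t) ε)) (+-identityʳ ε)

  module _ {c : Cap} {s t : Fin V} {f : Cap} where

    maxFlow⇒¬residualPath : IsMaxFlowST c s t f → s ≢ t → ¬ ResidualPath (residualCap c f) s t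
    maxFlow⇒¬residualPath (flow , maximal) s≢t path with STFlow.augment flow s≢t path
    ... | g , g-flow , f<g = ℚ.<-irrefl refl (<-≤-trans f<g (maximal g g-flow))

    maxFlow-value-nonNeg : NonNeg c → IsMaxFlowST c s t f → 0ℚ ≤ inflow f t
    maxFlow-value-nonNeg c-nonNeg (_ , maximal) =
      subst (_≤ inflow f t) (inflow-zero t) (maximal (λ _ → 0ℚ) zero-flow)
      where
      zero-flow : IsFlowST c s t (λ _ → 0ℚ)
      zero-flow = (λ _ → refl) , c-nonNeg , (λ v _ → inflow-zero v)

    maxFlow-source-nonPos : NonNeg c → IsMaxFlowST c s t f → s ≢ t → inflow f s ≤ 0ℚ
    maxFlow-source-nonPos c-nonNeg maxFlow s≢t =
      subst (_≤ 0ℚ) (sym (STFlow.inflow-source≡-sink (proj₁ maxFlow) s≢t))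
        (ℚ.neg-antimono-≤ (maxFlow-value-nonNeg c-nonNeg maxFlow))

open import Data.Nat using (ℕ; _≤_; _<_)
open import Data.Nat.Properties using (≤-<-trans)
open import Data.Fin using (Fin; toℕ; fromℕ<)
open import Data.Product using (∃; _×_; _,_; proj₁; proj₂; map₂)
open import Data.Sum using (_⊎_)
open import Relation.Binary.PropositionalEquality using (_≡_; _≢_)
open import Relation.Nullary using (¬_)

module AbstractFlow
  (M : CombMap) {m : ℕ} {s t : Fin m → Fin (CombMap.V M)} (s≢t : ∀ i j → s i ≢ t j)
  {c₀ : Flows.Cap M} (c₀-nonNeg : Flows.NonNeg M c₀)
  (c₀-settled : ∀ i j → toℕ i < toℕ j → ¬ Flows.ResidualPath M c₀ (s j) (t i))
  {cs fs : ℕ → ℕ → Flows.Cap M}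
  (maxFlowStep : ∀ i j (i≤j : i ≤ j) (j<m : j < m) →
     Flows.IsMaxFlowST M (prevCap c₀ cs i j) (s (fromℕ< (≤-<-trans i≤j j<m))) (t (fromℕ< j<m)) (fs i j)
     × (∀ d → cs i j d ≡ Flows.residualCap M (prevCap c₀ cs i j) (fs i j) d))
  where

  open CombMap M
  open Flows M
  open FlowTheory M

  open import Data.Nat using (zero; suc; z≤n; s≤s⁻¹; _≤‴_; ≤‴-refl; ≤‴-step; _<?_)
  open import Data.Nat.Properties as ℕ using (≤⇒≤‴; ≤‴⇒≤)
  open import Data.Fin.Properties using (toℕ-fromℕ<; toℕ-injective)
  open import Data.Product using (uncurry)
  open import Data.Sum using (inj₁; inj₂)
  open import Relation.Binary.PropositionalEquality using (refl; sym; trans; subst; subst₂)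
  open import Relation.Nullary using (yes; no; contradiction)
  open import Function using (_∘_)

  -- Settled ℓ k i j: once step (ℓ, k) has run (indices from 0), no residual walk from s i to t j
  -- may remain; just before that step, the same is required for Settled (suc ℓ) k i j.
  Settled : ℕ → ℕ → ℕ → ℕ → Set
  Settled ℓ k i j = j < k ⊎ (j ≡ k × ℓ ≤ i) ⊎ j < i

  NoSettledWalk : Cap → ℕ → ℕ → Set
  NoSettledWalk c ℓ k = ∀ i j → Settled ℓ k (toℕ i) (toℕ j) → ¬ ResidualWalk c (s i) (t j)

  settled-initial : ∀ {i j} → Settled 1 0 i j → j < i
  settled-initial (inj₂ (inj₁ (refl , 1≤i))) = 1≤i
  settled-initial (inj₂ (inj₂ j<i))          = j<i

  settled-nextRound : ∀ {k i j} → Settled (suc (suc k)) (suc k) i j → Settled 0 k i j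
  settled-nextRound (inj₁ j<1+k) with ℕ.m≤n⇒m<n∨m≡n (s≤s⁻¹ j<1+k)
  ... | inj₁ j<k = inj₁ j<k
  ... | inj₂ j≡k = inj₂ (inj₁ (j≡k , z≤n))
  settled-nextRound (inj₂ (inj₁ (refl , 2+k≤i))) = inj₂ (inj₂ 2+k≤i)
  settled-nextRound (inj₂ (inj₂ j<i))            = inj₂ (inj₂ j<i)

  settled-cases : ∀ {ℓ k i j} → ℓ ≤ k → Settled ℓ k i j →
                  j < k ⊎ (ℓ < i × Settled (suc ℓ) k i j) ⊎ (i ≡ ℓ × j ≡ k)
  settled-cases ℓ≤k (inj₁ j<k) = inj₁ j<k
  settled-cases ℓ≤k (inj₂ (inj₁ (j≡k , ℓ≤i))) with ℕ.m≤n⇒m<n∨m≡n ℓ≤i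
  ... | inj₁ ℓ<i = inj₂ (inj₁ (ℓ<i , inj₂ (inj₁ (j≡k , ℓ<i))))
  ... | inj₂ ℓ≡i = inj₂ (inj₂ (sym ℓ≡i , j≡k))
  settled-cases {k = k} {j = j} ℓ≤k (inj₂ (inj₂ j<i)) with j <? k
  ... | yes j<k = inj₁ j<k
  ... | no  j≮k = inj₂ (inj₁ (ℕ.≤-<-trans ℓ≤k (ℕ.≤-<-trans (ℕ.≮⇒≥ j≮k) j<i) ,
                              inj₂ (inj₂ j<i)))

  prevCap-inRound : ∀ {ℓ k} → ℓ < k → prevCap c₀ cs ℓ k ≡ cs (suc ℓ) k
  prevCap-inRound {ℓ} {k} ℓ<k with ℓ <? k
  ... | yes _   = refl
  ... | no  ℓ≮k = contradiction ℓ<k ℓ≮k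

  prevCap-newRound : ∀ k → prevCap c₀ cs (suc k) (suc k) ≡ cs 0 k
  prevCap-newRound k with suc k <? suc k
  ... | yes k<k = contradiction k<k (ℕ.<-irrefl refl)
  ... | no  _   = refl

  cs-nonNeg : ∀ {ℓ k} → ℓ ≤ k → k < m → NonNeg (cs ℓ k)
  cs-nonNeg {ℓ} {k} ℓ≤k k<m with maxFlowStep ℓ k ℓ≤k k<m
  ... | ((flow , _) , cs≗) = residualCap-nonNeg (proj₁ (proj₂ flow)) cs≗

  module _ {ℓ k} (ℓ≤k : ℓ ≤ k) (k<m : k < m) where

    private
      prev : Cap
      prev = prevCap c₀ cs ℓ k
      S T : Fin m
      S = fromℕ< (≤-<-trans ℓ≤k k<m)
      T = fromℕ< k<m
      maxFlow : IsMaxFlowST prev (s S) (t T) (fs ℓ k)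
      maxFlow = proj₁ (maxFlowStep ℓ k ℓ≤k k<m)
      residualWalk-prev : ∀ {u w} → ResidualWalk (cs ℓ k) u w →
                          ResidualWalk (residualCap prev (fs ℓ k)) u w
      residualWalk-prev = residualWalk-cong (proj₂ (maxFlowStep ℓ k ℓ≤k k<m))
      open STFlow (proj₁ maxFlow)

    settled-step : NonNeg prev → NoSettledWalk prev (suc ℓ) k → NoSettledWalk (cs ℓ k) ℓ k
    settled-step prev-nonNeg before i j settled walk with settled-cases ℓ≤k settled
    ... | inj₁ j<k =
      unreachable-to (maxFlow-value-nonNeg prev-nonNeg maxFlow)
        (before i j (inj₁ j<k)) (before S j (inj₁ j<k)) (residualWalk-prev walk)
    ... | inj₂ (inj₁ (ℓ<i , settled′)) =
      unreachable-from (maxFlow-source-nonPos prev-nonNeg maxFlow (s≢t S T))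
        (before i j settled′) (before i T (inj₂ (inj₁ (toℕ-fromℕ< k<m , ℓ<i))))
        (residualWalk-prev walk)
    ... | inj₂ (inj₂ (i≡ℓ , j≡k)) =
      maxFlow⇒¬residualPath maxFlow (s≢t S T) (residualWalk⇒residualPath
        (subst₂ (λ x y → ResidualWalk _ (s x) (t y)) i≡S j≡T (residualWalk-prev walk)))
      where
      i≡S : i ≡ S
      i≡S = toℕ-injective (trans i≡ℓ (sym (toℕ-fromℕ< _)))
      j≡T : j ≡ T
      j≡T = toℕ-injective (trans j≡k (sym (toℕ-fromℕ< k<m)))

  mutual

    settledAfter : ∀ {ℓ k} → ℓ ≤‴ k → k < m → NoSettledWalk (cs ℓ k) ℓ k
    settledAfter ℓ≤k k<m = uncurry (settled-step (≤‴⇒≤ ℓ≤k) k<m) (settledBefore ℓ≤k k<m)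

    settledBefore : ∀ {ℓ k} → ℓ ≤‴ k → k < m →
                    NonNeg (prevCap c₀ cs ℓ k) × NoSettledWalk (prevCap c₀ cs ℓ k) (suc ℓ) k
    settledBefore (≤‴-step 1+ℓ≤k) k<m rewrite prevCap-inRound (≤‴⇒≤ 1+ℓ≤k) =
      cs-nonNeg (≤‴⇒≤ 1+ℓ≤k) k<m , settledAfter 1+ℓ≤k k<m
    settledBefore {k = zero} ≤‴-refl _ =
      c₀-nonNeg , λ i j settled → c₀-settled j i (settled-initial settled) ∘ residualWalk⇒residualPath
    settledBefore {k = suc k} ≤‴-refl 1+k<m rewrite prevCap-newRound k =
      cs-nonNeg z≤n k<m ,
      λ i j settled → settledAfter (≤⇒≤‴ z≤n) k<m i j (settled-nextRound settled)
      where
      k<m : k < m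
      k<m = ℕ.<-trans (ℕ.n<1+n k) 1+k<m

  noResidualPath : ∀ i j {ℓ k} → ℓ ≤ k → toℕ j < k → k < m →
                   ¬ ResidualPath (cs ℓ k) (s i) (t j)
  noResidualPath i j ℓ≤k j<k k<m =
    settledAfter (≤⇒≤‴ ℓ≤k) k<m i j (inj₁ j<k) ∘ residualPath⇒residualWalk

mainTheorem5 : (M : CombMap) → IsPlane M →
  let open CombMap M
      open Flows M
  in (finf : Fin F) (m : ℕ) (s t : Fin m → Fin V) →
     Terminals.ClockwiseTerminals M finf m s t →
     (c : Cap) → NonNeg c →
     (c₀ : Cap) →
     (∃ λ g → IsFlow c (λ v → ∃ λ i → v ≡ s i ⊎ v ≡ t i) g
              × (∀ d → c₀ d ≡ residualCap c g d)) →
     NoResidualCWCycle finf c₀ →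
     (∀ i j → toℕ i < toℕ j → ¬ ResidualPath c₀ (s j) (t i)) →
     (cs fs : ℕ → ℕ → Cap) →
     (∀ i j (i≤j : i ≤ j) (j<m : j < m) →
        IsMaxFlowST (prevCap c₀ cs i j) (s (fromℕ< (≤-<-trans i≤j j<m)))
          (t (fromℕ< j<m)) (fs i j)
        × IsLeftmost finf (prevCap c₀ cs i j) (fs i j)
        × (∀ d → cs i j d ≡ residualCap (prevCap c₀ cs i j) (fs i j) d)) →
     ∀ (i j : Fin m) (ℓ k : ℕ) → ℓ ≤ k → toℕ j < k → k < m →
     ¬ ResidualPath (cs ℓ k) (s i) (t j)
mainTheorem5 M _ _ _ s t (_ , _ , s≢t , _) _ _ c₀ (_ , g-flow , c₀≗) _ c₀-settled cs fs steps i j _ _ =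
  AbstractFlow.noResidualPath M s≢t
    (FlowTheory.residualCap-nonNeg M (proj₁ (proj₂ g-flow)) c₀≗) c₀-settled
    (λ i j i≤j j<m → map₂ proj₂ (steps i j i≤j j<m)) i j
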